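{- Let $p\ge2$, $n\ge 6p-3$, and let $F\subseteq\{0,1,\dots,n-1\}$ be a facet of $\Delta_3(C_n^p)$ with $F\in\mathcal{A}_i$ for some $i\in\{1,\dots,n-2\}$; write $F^c=\{\omega_i,i_1,i_2\}$ with $i_1<i_2$. Then: (i) if $\omega_i-p\le i_1<\omega_i$, then $i_2\nsim\omega_i$ and $i_2\ge\omega_i+p+1>\omega_i$; (ii) if $\omega_i<i_2\le\omega_i+p$, then $i_1\nsim\omega_i$ and $i_1\le\omega_i-p-1<\omega_i$; (iii) if $i_1<i_2<\omega_i$, then $i_1\nsim\omega_i$; (iv) if $\omega_i<i_1<i_2$, then $i_2\nsim\omega_i$. Here $u\sim v$ denotes adjacency in $C_n^p$ and $u\nsim v$ non-adjacency.
   Context: $C_n^p$ is the graph on vertex set $\{0,1,\dots,n-1\}$ in which $u$ and $v$ are adjacent iff $v\equiv u\pm j \pmod n$ for some $j\in\{1,\dots,p\}$. A facet of the $3$-cut complex $\Delta_3(C_n^p)$ is a subset $F$ of the vertex set with $|F|=n-3$ such that the induced subgraph of $C_n^p$ on the complement $F^c$ is disconnected. Let $\mathbf{c}=\frac{n+1}{2}$ if $n$ is odd and $\mathbf{c}=\frac n2$ if $n$ is even. For $i\in\{1,\dots,n\}$ define $\omega_i = \mathbf{c}+(-1)^{i-1}\lfloor i/2\rfloor \pmod n$ (an enumeration $\mathbf{c},\mathbf{c}-1,\mathbf{c}+1,\mathbf{c}-2,\dots$ of all vertices). For a subset $A$ of the vertex set with $|A|=n-3$, $A\in\mathcal{A}_i$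 means $\omega_i\notin A$ and $\omega_1,\dots,\omega_{i-1}\in A$. All inequalities between vertices are inequalities between the integers $0,\dots,n-1$. -}

module Defs where

open import Data.Nat using (ℕ; zero; suc; _+_; _*_; _∸_; _≤_; _<_; NonZero)
open import Data.Nat.DivMod using (_/_; _%_; _mod_)
open import Data.Fin using (Fin; toℕ)
open import Data.Fin.Subset using (Subset; _∈_; _∉_; ∁; ∣_∣)
open import Data.Product using (Σ; ∃; _×_; _,_)
open import Data.Sum using (_⊎_)
open import Relation.Binary.PropositionalEquality using (_≡_)
open import Relation.Nullary using (¬_)

Adj : (n p : ℕ) .{{_ : NonZero n}} → Fin n → Fin n → Set
Adj n p u v = ∃ λ j → 1 ≤ j × j ≤ p ×
  (((toℕ u + j) % n ≡ toℕ v % n) ⊎ ((toℕ v + j) % n ≡ toℕ u % n))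

data Reach (n p : ℕ) .{{_ : NonZero n}} (S : Subset n) : Fin n → Fin n → Set where
  here : ∀ {x} → x ∈ S → Reach n p S x x
  step : ∀ {x y z} → x ∈ S → Adj n p x y → Reach n p S y z → Reach n p S x z

Connected : (n p : ℕ) .{{_ : NonZero n}} → Subset n → Set
Connected n p S = (∃ λ x → x ∈ S) × (∀ x y → x ∈ S → y ∈ S → Reach n p S x y)

Facet3 : (n p : ℕ) .{{_ : NonZero n}} → Subset n → Set
Facet3 n p F = (∣ F ∣ ≡ n ∸ 3) × ¬ Connected n p (∁ F)

-- the centre c = (n+1)/2 for n odd, n/2 for n even; both equal ⌊(n+1)/2⌋
centre : ℕ → ℕ
centre n = (n + 1) / 2

omega : (n : ℕ) .{{_ : NonZero n}} → ℕ → Fin n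
omega n i with i % 2
... | 0 = (centre n ∸ (i / 2)) mod n   -- i even: c - ⌊i/2⌋ ≥ 0 since i ≤ n
... | _ = (centre n + (i / 2)) mod n

InA : (n : ℕ) .{{_ : NonZero n}} → ℕ → Subset n → Set
InA n i F = (omega n i ∉ F) × (∀ k → 1 ≤ k → k < i → omega n k ∈ F)

-- Let rank x be the position of a vertex x in the enumeration ω₁, ω₂, …: it is 2t+1 at
-- distance t above the centre c and 2t at distance t below it.  As F ∈ 𝒜ᵢ contains
-- ω₁, …, ω_{i-1}, every vertex x ∉ F has rank x ≥ i = rank ωᵢ, so x is at least as far from
-- c as ωᵢ: x < ωᵢ forces x + ωᵢ < 2c ≤ n + 1 and x > ωᵢ forces x + ωᵢ ≥ 2c ≥ n.
-- Since F^c = {ωᵢ, i₁, i₂} induces a disconnected graph, at most one of its three pairs is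
-- adjacent; this alone gives (i) and (ii).  In (iii) and (iv) the remaining adjacency would
-- have to wrap around 0 (u + n ≤ v + p for u < v), which these two inequalities rule out.
module Submission where

open import Defs
open import Data.Nat using (ℕ; zero; suc; _+_; _*_; _∸_; _≤_; _<_; NonZero; z≤n; s≤s; s≤s⁻¹; z<s)
open import Data.Nat.Properties
open import Data.Nat.DivMod using (_%_; _/_; m≡m%n+[m/n]*n; m/n*n≤m; m%n<n; m%n≤m; m<n⇒m%n≡m; [m+kn]%n≡m%n; m*n%n≡0; m*n/n≡m; +-distrib-/)
open import Data.Fin using (Fin; toℕ) renaming (_≟_ to _≟ᶠ_)
open import Data.Fin.Properties using (toℕ-injective; toℕ<n; toℕ-fromℕ<)
open import Data.Fin.Subset using (Subset; _∈_; _∉_; ∁; ∣_∣)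
open import Data.Fin.Subset.Properties using (x∉p⇒x∈∁p; ∣∁p∣≡n∸∣p∣; x∈p⇒∣p-x∣<∣p∣; x∈p∧x≢y⇒x∈p-y)
open import Data.Product using (_×_; _,_; proj₁; proj₂)
open import Data.Sum using (_⊎_; inj₁; inj₂)
open import Data.Empty using (⊥)
open import Function using (_∘_)
open import Relation.Binary.Definitions using (tri<; tri≈; tri>)
open import Relation.Binary.PropositionalEquality
open import Relation.Nullary using (¬_; yes; no; contradiction)

m+m≡m*2 : ∀ m → m + m ≡ m * 2
m+m≡m*2 m = sym (trans (*-comm m 2) (cong (m +_) (+-identityʳ m)))

data Half : ℕ → Set where
  even : ∀ m → Half (m * 2)
  odd  : ∀ m → Half (suc (m * 2))

half : ∀ i → Half i
half zero = even 0
half (suc i) with half i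
... | even m = odd m
... | odd m  = even (suc m)

odd≤odd⇒≤ : ∀ {s t} → suc (t * 2) ≤ suc (s * 2) → t ≤ s
odd≤odd⇒≤ {s} {t} le = *-cancelʳ-≤ t s 2 (s≤s⁻¹ le)

even≤even⇒≤ : ∀ {s t} → suc t * 2 ≤ suc s * 2 → t ≤ s
even≤even⇒≤ {s} {t} le = s≤s⁻¹ (*-cancelʳ-≤ (suc t) (suc s) 2 le)

odd≤even⇒≤ : ∀ {s t} → suc (t * 2) ≤ suc s * 2 → t ≤ s
odd≤even⇒≤ {s} {t} le = s≤s⁻¹ (*-cancelʳ-< 2 t (suc s) le)

even≤odd⇒< : ∀ {s t} → suc t * 2 ≤ suc (s * 2) → t < s
even≤odd⇒< {s} {t} le = *-cancelʳ-< 2 t s (s≤s⁻¹ le)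

%≡-<⇒+n≤ : ∀ {a b n} .{{_ : NonZero n}} → a % n ≡ b → b < a → b + n ≤ a
%≡-<⇒+n≤ {a} {b} {n} a%n≡b b<a with a / n | m≡m%n+[m/n]*n a n
... | zero  | a≡a%n+0 = contradiction (trans a≡a%n+0 (trans (+-identityʳ _) a%n≡b)) (≢-sym (<⇒≢ b<a))
... | suc k | a≡a%n+[1+k]n = begin
  b + n             ≤⟨ +-monoʳ-≤ b (m≤m+n n (k * n)) ⟩
  b + suc k * n     ≡⟨ cong (_+ suc k * n) a%n≡b ⟨
  a % n + suc k * n ≡⟨ a≡a%n+[1+k]n ⟨
  a                 ∎
  where open ≤-Reasoning

centre*2≤n+1 : ∀ n → centre n * 2 ≤ n + 1
centre*2≤n+1 n = m/n*n≤m (n + 1) 2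

n≤centre*2 : ∀ n → n ≤ centre n * 2
n≤centre*2 n = s≤s⁻¹ (begin
  suc n                          ≡⟨ +-comm 1 n ⟩
  n + 1                          ≡⟨ m≡m%n+[m/n]*n (n + 1) 2 ⟩
  (n + 1) % 2 + centre n * 2     ≤⟨ +-monoˡ-≤ (centre n * 2) (s≤s⁻¹ (m%n<n (n + 1) 2)) ⟩
  suc (centre n * 2)             ∎)
  where open ≤-Reasoning

centre<n : ∀ {n} → 2 ≤ n → centre n < n
centre<n {n} 2≤n = *-cancelʳ-< 2 (centre n) n (begin-strict
  centre n * 2 ≤⟨ centre*2≤n+1 n ⟩
  n + 1        <⟨ +-monoʳ-< n 2≤n ⟩
  n + n        ≡⟨ m+m≡m*2 n ⟩
  n * 2        ∎)
  where open ≤-Reasoning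

m*2≤n⇒m≤centre : ∀ {m n} → m * 2 ≤ n → m ≤ centre n
m*2≤n⇒m≤centre {m} {n} m*2≤n = *-cancelʳ-≤ m (centre n) 2 (≤-trans m*2≤n (n≤centre*2 n))

1+m*2<n⇒centre+m<n : ∀ {m n} → suc (m * 2) < n → centre n + m < n
1+m*2<n⇒centre+m<n {m} {n} 1+m*2<n = *-cancelʳ-< 2 (centre n + m) n (begin-strict
  (centre n + m) * 2       ≡⟨ *-distribʳ-+ 2 (centre n) m ⟩
  centre n * 2 + m * 2     ≤⟨ +-monoˡ-≤ (m * 2) (centre*2≤n+1 n) ⟩
  n + 1 + m * 2            ≡⟨ +-assoc n 1 (m * 2) ⟩
  n + suc (m * 2)          <⟨ +-monoʳ-< n 1+m*2<n ⟩
  n + n                    ≡⟨ m+m≡m*2 n ⟩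
  n * 2                    ∎)
  where open ≤-Reasoning

[1+t*2]/2≡t : ∀ t → suc (t * 2) / 2 ≡ t
[1+t*2]/2≡t t = trans (+-distrib-/ 1 (t * 2) (subst (λ r → 1 + r < 2) (sym (m*n%n≡0 t 2)) ≤-refl))
                      (m*n/n≡m t 2)

omega-odd : ∀ n .{{_ : NonZero n}} t → toℕ (omega n (suc (t * 2))) ≡ (centre n + t) % n
omega-odd n t rewrite [m+kn]%n≡m%n 1 t 2 {{_}} | [1+t*2]/2≡t t = toℕ-fromℕ< _

omega-even : ∀ n .{{_ : NonZero n}} t → toℕ (omega n (t * 2)) ≡ (centre n ∸ t) % n
omega-even n t rewrite m*n%n≡0 t 2 {{_}} | m*n/n≡m t 2 {{_}} = toℕ-fromℕ< _

data Side (c x : ℕ) : Set where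
  above : ∀ t → x ≡ c + t → Side c x
  below : ∀ t → x + suc t ≡ c → Side c x

side : ∀ c x → Side c x
side c x with c ≤? x
... | yes c≤x = above (x ∸ c) (sym (m+[n∸m]≡n c≤x))
... | no  c≰x = below (c ∸ suc x) (trans (+-suc x _) (m+[n∸m]≡n (≰⇒> c≰x)))

rank : ℕ → ℕ → ℕ
rank c x with side c x
... | above t _ = suc (t * 2)
... | below t _ = suc t * 2

below⇒< : ∀ {c x t} → x + suc t ≡ c → x < c
below⇒< {x = x} x+1+t≡c = subst (x <_) x+1+t≡c (m<m+n x z<s)

above⇒≤ : ∀ {c x t} → x ≡ c + t → c ≤ x
above⇒≤ {c} {t = t} x≡c+t = subst (c ≤_) (sym x≡c+t) (m≤m+n c t)

above-below-disjoint : ∀ {c x s t} → x ≡ c + s → x + suc t ≡ c → ⊥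
above-below-disjoint x≡c+s x+1+t≡c = <⇒≱ (below⇒< x+1+t≡c) (above⇒≤ x≡c+s)

rank-positive : ∀ c x → 1 ≤ rank c x
rank-positive c x with side c x
... | above t _ = s≤s z≤n
... | below t _ = s≤s z≤n

rank-above : ∀ c t → rank c (c + t) ≡ suc (t * 2)
rank-above c t with side c (c + t)
... | above s c+t≡c+s = cong (λ u → suc (u * 2)) (sym (+-cancelˡ-≡ c t s c+t≡c+s))
... | below s c+t+1+s≡c = contradiction c+t+1+s≡c (above-below-disjoint refl)

rank-below : ∀ {c x} t → x + suc t ≡ c → rank c x ≡ suc t * 2
rank-below {c} {x} t x+1+t≡c with side c x
... | above s x≡c+s = contradiction x+1+t≡c (above-below-disjoint x≡c+s)
... | below s x+1+s≡c = cong (_* 2) (+-cancelˡ-≡ x (suc s) (suc t) (trans x+1+s≡c (sym x+1+t≡c)))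

rank-reflect-< : ∀ c {x y} → x < y → rank c y ≤ rank c x → x + y < c + c
rank-reflect-< c {x} {y} x<y r with side c x | side c y
... | above s refl | above t refl = contradiction (odd≤odd⇒≤ r) (<⇒≱ (+-cancelˡ-< c s t x<y))
... | above s refl | below t y<c = contradiction (<-trans x<y (below⇒< y<c)) (≤⇒≯ (m≤m+n c s))
... | below s refl | above t refl = begin-strict
  x + (c + t)       <⟨ +-monoʳ-< x (+-monoʳ-< c (s≤s (odd≤even⇒≤ r))) ⟩
  x + (c + suc s)   ≡⟨ +-assoc x c (suc s) ⟨
  (x + c) + suc s   ≡⟨ cong (_+ suc s) (+-comm x c) ⟩
  (c + x) + suc s   ≡⟨ +-assoc c x (suc s) ⟩
  c + c             ∎
  where open ≤-Reasoning
... | below s x<c | below t y<c = +-mono-< (below⇒< x<c) (below⇒< y<c)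

rank-reflect-> : ∀ c {x y} → y < x → rank c y ≤ rank c x → c + c ≤ x + y
rank-reflect-> c {x} {y} y<x r with side c x | side c y
... | above s x≡c+s | above t y≡c+t = +-mono-≤ (above⇒≤ {c} {x} x≡c+s) (above⇒≤ {c} {y} y≡c+t)
... | above s refl | below t refl = begin
  c + (y + suc t)   ≤⟨ +-monoʳ-≤ c (+-monoʳ-≤ y (even≤odd⇒< r)) ⟩
  c + (y + s)       ≡⟨ cong (c +_) (+-comm y s) ⟩
  c + (s + y)       ≡⟨ +-assoc c s y ⟨
  (c + s) + y       ∎
  where open ≤-Reasoning
... | below s x<c | above t y≡c+t = contradiction (<-trans y<x (below⇒< x<c)) (≤⇒≯ (above⇒≤ y≡c+t))
... | below s refl | below t y+1+t≡c = contradiction y<x (≤⇒≯ (+-cancelʳ-≤ (suc s) x y (begin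
  x + suc s         ≡⟨ y+1+t≡c ⟨
  y + suc t         ≤⟨ +-monoʳ-≤ y (s≤s (even≤even⇒≤ r)) ⟩
  y + suc s         ∎)))
  where open ≤-Reasoning

rank-omega : ∀ {n} .{{_ : NonZero n}} {i} → 1 ≤ i → i < n → rank (centre n) (toℕ (omega n i)) ≡ i
rank-omega {n} {i} 1≤i i<n with half i
... | even (suc m) = begin
  rank c (toℕ (omega n (suc m * 2))) ≡⟨ cong (rank c) (omega-even n (suc m)) ⟩
  rank c ((c ∸ suc m) % n)           ≡⟨ cong (rank c) (m<n⇒m%n≡m c-m<n) ⟩
  rank c (c ∸ suc m)                 ≡⟨ rank-below m (m∸n+n≡m m<c) ⟩
  suc m * 2                          ∎
  where
  open ≡-Reasoning
  c = centre n
  m<c : suc m ≤ c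
  m<c = m*2≤n⇒m≤centre (<⇒≤ i<n)
  c-m<n : c ∸ suc m < n
  c-m<n = ≤-<-trans (m∸n≤m c (suc m)) (centre<n (≤-<-trans 1≤i i<n))
... | odd m = begin
  rank c (toℕ (omega n (suc (m * 2)))) ≡⟨ cong (rank c) (omega-odd n m) ⟩
  rank c ((c + m) % n)                 ≡⟨ cong (rank c) (m<n⇒m%n≡m (1+m*2<n⇒centre+m<n i<n)) ⟩
  rank c (c + m)                       ≡⟨ rank-above c m ⟩
  suc (m * 2)                          ∎
  where
  open ≡-Reasoning
  c = centre n

omega-rank : ∀ {n} .{{_ : NonZero n}} (x : Fin n) → omega n (rank (centre n) (toℕ x)) ≡ x
omega-rank {n} x with side (centre n) (toℕ x)
... | above t x≡c+t = toℕ-injective (begin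
  toℕ (omega n (suc (t * 2))) ≡⟨ omega-odd n t ⟩
  (centre n + t) % n          ≡⟨ cong (_% n) x≡c+t ⟨
  toℕ x % n                   ≡⟨ m<n⇒m%n≡m (toℕ<n x) ⟩
  toℕ x                       ∎)
  where open ≡-Reasoning
... | below t x+1+t≡c = toℕ-injective (begin
  toℕ (omega n (suc t * 2))   ≡⟨ omega-even n (suc t) ⟩
  (centre n ∸ suc t) % n      ≡⟨ cong (λ c → (c ∸ suc t) % n) x+1+t≡c ⟨
  (toℕ x + suc t ∸ suc t) % n ≡⟨ cong (_% n) (m+n∸n≡m (toℕ x) (suc t)) ⟩
  toℕ x % n                   ≡⟨ m<n⇒m%n≡m (toℕ<n x) ⟩
  toℕ x                       ∎)
  where open ≡-Reasoning

∣p∣≤3⇒⊆three : ∀ {m} {S : Subset m} {a b c x} → ∣ S ∣ ≤ 3 → a ∈ S → b ∈ S → c ∈ S →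
  a ≢ b → a ≢ c → b ≢ c → x ∈ S → x ≡ a ⊎ x ≡ b ⊎ x ≡ c
∣p∣≤3⇒⊆three {S = S} {a} {b} {c} {x} ∣S∣≤3 a∈S b∈S c∈S a≢b a≢c b≢c x∈S
  with x ≟ᶠ a | x ≟ᶠ b | x ≟ᶠ c
... | yes x≡a | _       | _       = inj₁ x≡a
... | no _    | yes x≡b | _       = inj₂ (inj₁ x≡b)
... | no _    | no _    | yes x≡c = inj₂ (inj₂ x≡c)
... | no x≢a  | no x≢b  | no x≢c  = contradiction ∣S∣≤3 (<⇒≱ 3<∣S∣)
  where
  b∈S-a = x∈p∧x≢y⇒x∈p-y b∈S (≢-sym a≢b)
  c∈S-a-b = x∈p∧x≢y⇒x∈p-y (x∈p∧x≢y⇒x∈p-y c∈S (≢-sym a≢c)) (≢-sym b≢c)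
  x∈S-a-b-c = x∈p∧x≢y⇒x∈p-y (x∈p∧x≢y⇒x∈p-y (x∈p∧x≢y⇒x∈p-y x∈S x≢a) x≢b) x≢c
  3<∣S∣ : 3 < ∣ S ∣
  3<∣S∣ = ≤-<-trans (≤-<-trans (≤-<-trans (≤-<-trans z≤n (x∈p⇒∣p-x∣<∣p∣ x∈S-a-b-c))
            (x∈p⇒∣p-x∣<∣p∣ c∈S-a-b)) (x∈p⇒∣p-x∣<∣p∣ b∈S-a)) (x∈p⇒∣p-x∣<∣p∣ a∈S)

module _ {n p : ℕ} .{{_ : NonZero n}} where

  Adj-sym : ∀ {u v} → Adj n p u v → Adj n p v u
  Adj-sym (j , 1≤j , j≤p , inj₁ e) = j , 1≤j , j≤p , inj₂ e
  Adj-sym (j , 1≤j , j≤p , inj₂ e) = j , 1≤j , j≤p , inj₁ e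

  Adj-near : ∀ {u v} → toℕ u < toℕ v → toℕ v ≤ toℕ u + p → Adj n p u v
  Adj-near {u} {v} u<v v≤u+p = toℕ v ∸ toℕ u , m<n⇒0<n∸m u<v , m≤n+o⇒m∸n≤o (toℕ v) (toℕ u) v≤u+p ,
    inj₁ (cong (_% n) (m+[n∸m]≡n (<⇒≤ u<v)))

  ¬Adj⇒far : ∀ {u v} → toℕ u < toℕ v → ¬ Adj n p u v → toℕ u + p < toℕ v
  ¬Adj⇒far u<v ¬uv = ≰⇒> (¬uv ∘ Adj-near u<v)

  Adj-near-or-wrap : ∀ {u v} → toℕ u < toℕ v → Adj n p u v →
    toℕ v ≤ toℕ u + p ⊎ toℕ u + n ≤ toℕ v + p
  Adj-near-or-wrap {u} {v} u<v (j , _ , j≤p , inj₁ [u+j]%n≡v%n) = inj₁ (begin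
    toℕ v             ≡⟨ m<n⇒m%n≡m (toℕ<n v) ⟨
    toℕ v % n         ≡⟨ [u+j]%n≡v%n ⟨
    (toℕ u + j) % n   ≤⟨ m%n≤m (toℕ u + j) n ⟩
    toℕ u + j         ≤⟨ +-monoʳ-≤ (toℕ u) j≤p ⟩
    toℕ u + p         ∎)
    where open ≤-Reasoning
  Adj-near-or-wrap {u} {v} u<v (j , _ , j≤p , inj₂ [v+j]%n≡u%n) = inj₂ (begin
    toℕ u + n         ≤⟨ %≡-<⇒+n≤ (trans [v+j]%n≡u%n (m<n⇒m%n≡m (toℕ<n u))) (≤-trans u<v (m≤m+n (toℕ v) j)) ⟩
    toℕ v + j         ≤⟨ +-monoʳ-≤ (toℕ v) j≤p ⟩
    toℕ v + p         ∎)
    where open ≤-Reasoning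

  Reach-trans : ∀ {S x y z} → Reach n p S x y → Reach n p S y z → Reach n p S x z
  Reach-trans (here _)           yz = yz
  Reach-trans (step x∈S xy′ y′y) yz = step x∈S xy′ (Reach-trans y′y yz)

  path⇒Connected : ∀ {S u v w} → u ∈ S → v ∈ S → w ∈ S →
    (∀ {x} → x ∈ S → x ≡ u ⊎ x ≡ v ⊎ x ≡ w) → Adj n p u v → Adj n p v w → Connected n p S
  path⇒Connected {S} {u} {v} {w} u∈S v∈S w∈S S⊆uvw uv vw =
    (v , v∈S) , λ x y x∈S y∈S → Reach-trans (to-v x∈S) (from-v y∈S)
    where
    to-v : ∀ {x} → x ∈ S → Reach n p S x v
    to-v x∈S with S⊆uvw x∈S
    ... | inj₁ refl        = step u∈S uv (here v∈S)
    ... | inj₂ (inj₁ refl) = here v∈S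
    ... | inj₂ (inj₂ refl) = step w∈S (Adj-sym vw) (here v∈S)
    from-v : ∀ {y} → y ∈ S → Reach n p S v y
    from-v y∈S with S⊆uvw y∈S
    ... | inj₁ refl        = step v∈S (Adj-sym uv) (here u∈S)
    ... | inj₂ (inj₁ refl) = here v∈S
    ... | inj₂ (inj₂ refl) = step v∈S vw (here w∈S)

  Facet3⇒∣∁∣≤3 : ∀ {F} → Facet3 n p F → ∣ ∁ F ∣ ≤ 3
  Facet3⇒∣∁∣≤3 {F} (∣F∣≡n-3 , _) = begin
    ∣ ∁ F ∣         ≡⟨ ∣∁p∣≡n∸∣p∣ F ⟩
    n ∸ ∣ F ∣       ≡⟨ cong (n ∸_) ∣F∣≡n-3 ⟩
    n ∸ (n ∸ 3)     ≤⟨ m≤n+o⇒m∸n≤o n (n ∸ 3) (subst (n ≤_) (+-comm 3 (n ∸ 3)) (m≤n+m∸n n 3)) ⟩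
    3               ∎
    where open ≤-Reasoning

  Facet3-no-path : ∀ {F x y z} → Facet3 n p F → x ∉ F → y ∉ F → z ∉ F →
    x ≢ y → x ≢ z → y ≢ z → Adj n p x y → Adj n p y z → ⊥
  Facet3-no-path facet@(_ , disconnected) x∉F y∉F z∉F x≢y x≢z y≢z xy yz =
    disconnected (path⇒Connected x∈∁F y∈∁F z∈∁F
      (∣p∣≤3⇒⊆three (Facet3⇒∣∁∣≤3 facet) x∈∁F y∈∁F z∈∁F x≢y x≢z y≢z) xy yz)
    where
    x∈∁F = x∉p⇒x∈∁p x∉F
    y∈∁F = x∉p⇒x∈∁p y∉F
    z∈∁F = x∉p⇒x∈∁p z∉F

module _ {n : ℕ} .{{_ : NonZero n}} {i : ℕ} {F : Subset n} (F∈𝒜ᵢ : InA n i F) (1≤i : 1 ≤ i) (i<n : i < n) where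

  private
    c = centre n
    ω = toℕ (omega n i)

  rank-omega≤rank-∉ : ∀ {x} → x ∉ F → rank c ω ≤ rank c (toℕ x)
  rank-omega≤rank-∉ {x} x∉F rewrite rank-omega {n} 1≤i i<n = ≮⇒≥ λ rank<i →
    x∉F (subst (_∈ F) (omega-rank x) (proj₂ F∈𝒜ᵢ _ (rank-positive c (toℕ x)) rank<i))

  ∉-below-omega : ∀ {x} → x ∉ F → toℕ x < ω → toℕ x + ω ≤ n
  ∉-below-omega {x} x∉F x<ω = s≤s⁻¹ (begin-strict
    toℕ x + ω   <⟨ rank-reflect-< c x<ω (rank-omega≤rank-∉ x∉F) ⟩
    c + c       ≡⟨ m+m≡m*2 c ⟩
    c * 2       ≤⟨ centre*2≤n+1 n ⟩
    n + 1       ≡⟨ +-comm n 1 ⟩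
    suc n       ∎)
    where open ≤-Reasoning

  ∉-above-omega : ∀ {x} → x ∉ F → ω < toℕ x → n ≤ toℕ x + ω
  ∉-above-omega {x} x∉F ω<x = begin
    n           ≤⟨ n≤centre*2 n ⟩
    c * 2       ≡⟨ m+m≡m*2 c ⟨
    c + c       ≤⟨ rank-reflect-> c ω<x (rank-omega≤rank-∉ x∉F) ⟩
    toℕ x + ω   ∎
    where open ≤-Reasoning

module ThreeCut {n p : ℕ} .{{_ : NonZero n}} {F : Subset n} (facet : Facet3 n p F)
  {i : ℕ} (1≤i : 1 ≤ i) (i<n : i < n) (F∈𝒜ᵢ : InA n i F)
  {a b : Fin n} (a<b : toℕ a < toℕ b) (a∉F : a ∉ F) (b∉F : b ∉ F)
  (a≢ω : a ≢ omega n i) (b≢ω : b ≢ omega n i) where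

  private
    ω = omega n i
    ω∉F = proj₁ F∈𝒜ᵢ

    a≢b : a ≢ b
    a≢b refl = <-irrefl refl a<b

    no-a-ω-b : Adj n p a ω → Adj n p ω b → ⊥
    no-a-ω-b = Facet3-no-path facet a∉F ω∉F b∉F a≢ω a≢b (≢-sym b≢ω)

    no-ω-a-b : Adj n p ω a → Adj n p a b → ⊥
    no-ω-a-b = Facet3-no-path facet ω∉F a∉F b∉F (≢-sym a≢ω) (≢-sym b≢ω) a≢b

    no-a-b-ω : Adj n p a b → Adj n p b ω → ⊥
    no-a-b-ω = Facet3-no-path facet a∉F b∉F ω∉F a≢b a≢ω b≢ω

    <⇒+1≤ : ∀ {m k} → m < k → m + 1 ≤ k
    <⇒+1≤ {m} {k} = subst (_≤ k) (+-comm 1 m)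

  part-i : toℕ ω ≤ toℕ a + p → toℕ a < toℕ ω →
    ¬ Adj n p b ω × toℕ ω + p + 1 ≤ toℕ b × toℕ ω < toℕ b
  part-i ω≤a+p a<ω = ¬bω , <⇒+1≤ (¬Adj⇒far ω<b (¬bω ∘ Adj-sym)) , ω<b
    where
    ¬bω : ¬ Adj n p b ω
    ¬bω bω = no-a-ω-b (Adj-near a<ω ω≤a+p) (Adj-sym bω)
    ω<b : toℕ ω < toℕ b
    ω<b with <-cmp (toℕ ω) (toℕ b)
    ... | tri< ω<b _ _ = ω<b
    ... | tri≈ _ ω≡b _ = contradiction (toℕ-injective (sym ω≡b)) b≢ω
    ... | tri> _ _ b<ω = contradiction (Adj-near b<ω (≤-trans ω≤a+p (+-monoˡ-≤ p (<⇒≤ a<b)))) ¬bω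

  part-ii : toℕ ω < toℕ b → toℕ b ≤ toℕ ω + p →
    ¬ Adj n p a ω × toℕ a + p + 1 ≤ toℕ ω × toℕ a < toℕ ω
  part-ii ω<b b≤ω+p = ¬aω , <⇒+1≤ (¬Adj⇒far a<ω ¬aω) , a<ω
    where
    ¬aω : ¬ Adj n p a ω
    ¬aω aω = no-a-ω-b aω (Adj-near ω<b b≤ω+p)
    a<ω : toℕ a < toℕ ω
    a<ω with <-cmp (toℕ a) (toℕ ω)
    ... | tri< a<ω _ _ = a<ω
    ... | tri≈ _ a≡ω _ = contradiction (toℕ-injective a≡ω) a≢ω
    ... | tri> _ _ ω<a = contradiction (Adj-sym (Adj-near ω<a (≤-trans (<⇒≤ a<b) b≤ω+p))) ¬aω

  part-iii : toℕ b < toℕ ω → ¬ Adj n p a ω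
  part-iii b<ω aω with Adj-near-or-wrap (<-trans a<b b<ω) aω
  ... | inj₁ ω≤a+p = no-a-ω-b aω (Adj-sym (Adj-near b<ω (≤-trans ω≤a+p (+-monoˡ-≤ p (<⇒≤ a<b)))))
  ... | inj₂ a+n≤ω+p = <⇒≱ ω+p<a+n a+n≤ω+p
    where
    open ≤-Reasoning
    a+p<b = ¬Adj⇒far a<b (no-ω-a-b (Adj-sym aω))
    ω+p<a+n : toℕ ω + p < toℕ a + n
    ω+p<a+n = begin-strict
      toℕ ω + p             ≡⟨ +-comm (toℕ ω) p ⟩
      p + toℕ ω             ≤⟨ +-monoˡ-≤ (toℕ ω) (m≤n+m p (toℕ a)) ⟩
      toℕ a + p + toℕ ω     <⟨ +-monoˡ-< (toℕ ω) a+p<b ⟩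
      toℕ b + toℕ ω         ≤⟨ ∉-below-omega F∈𝒜ᵢ 1≤i i<n b∉F b<ω ⟩
      n                     ≤⟨ m≤n+m n (toℕ a) ⟩
      toℕ a + n             ∎

  part-iv : toℕ ω < toℕ a → ¬ Adj n p b ω
  part-iv ω<a bω with Adj-near-or-wrap (<-trans ω<a a<b) (Adj-sym bω)
  ... | inj₁ b≤ω+p = no-a-ω-b (Adj-sym (Adj-near ω<a (≤-trans (<⇒≤ a<b) b≤ω+p))) (Adj-sym bω)
  ... | inj₂ ω+n≤b+p = <-asym ω<p p<ω
    where
    open ≤-Reasoning
    a+p<b = ¬Adj⇒far a<b (λ ab → no-a-b-ω ab bω)
    ω<p : toℕ ω < p
    ω<p = +-cancelʳ-< n (toℕ ω) p (begin-strict
      toℕ ω + n             ≤⟨ ω+n≤b+p ⟩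
      toℕ b + p             <⟨ +-monoˡ-< p (toℕ<n b) ⟩
      n + p                 ≡⟨ +-comm n p ⟩
      p + n                 ∎)
    p<ω : p < toℕ ω
    p<ω = +-cancelˡ-< (toℕ a) p (toℕ ω) (begin-strict
      toℕ a + p             <⟨ a+p<b ⟩
      toℕ b                 <⟨ toℕ<n b ⟩
      n                     ≤⟨ ∉-above-omega F∈𝒜ᵢ 1≤i i<n a∉F ω<a ⟩
      toℕ a + toℕ ω         ∎)

proposition3p11 : (p n : ℕ) .{{_ : NonZero n}} → 2 ≤ p → 6 * p ∸ 3 ≤ n →
    (F : Subset n) → Facet3 n p F →
    (i : ℕ) → 1 ≤ i → i ≤ n ∸ 2 → InA n i F →
    (i₁ i₂ : Fin n) → toℕ i₁ < toℕ i₂ → i₁ ∉ F → i₂ ∉ F →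
    i₁ ≢ omega n i → i₂ ≢ omega n i →
      ((toℕ (omega n i) ≤ toℕ i₁ + p → toℕ i₁ < toℕ (omega n i) →
          ¬ Adj n p i₂ (omega n i) × toℕ (omega n i) + p + 1 ≤ toℕ i₂ × toℕ (omega n i) < toℕ i₂)
      × (toℕ (omega n i) < toℕ i₂ → toℕ i₂ ≤ toℕ (omega n i) + p →
          ¬ Adj n p i₁ (omega n i) × toℕ i₁ + p + 1 ≤ toℕ (omega n i) × toℕ i₁ < toℕ (omega n i))
      × (toℕ i₂ < toℕ (omega n i) → ¬ Adj n p i₁ (omega n i))
      × (toℕ (omega n i) < toℕ i₁ → ¬ Adj n p i₂ (omega n i)))
proposition3p11 p n _ _ F facet i 1≤i i≤n∸2 F∈𝒜ᵢ i₁ i₂ i₁<i₂ i₁∉F i₂∉F i₁≢ω i₂≢ω =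
  part-i , part-ii , part-iii , part-iv
  where
  i<n : i < n
  i<n = ≤-<-trans i≤n∸2 (m<n+o⇒m∸n<o n 2 (m<n+m n z<s))
  open ThreeCut facet 1≤i i<n F∈𝒜ᵢ i₁<i₂ i₁∉F i₂∉F i₁≢ω i₂≢ω
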